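{- Let $p$ be an odd prime, $\varepsilon\in\{ -1,1\}$, and $z\in\mathbb{Z}$ with $\gcd(p,z(z+1))=1$. Then \[ \sum_{k=0}^{p-1}(2k+1)\varepsilon^kS_k(z)\equiv 1\pmod{p} \quad\text{and}\quad \sum_{k=0}^{p-1}(2k+1)\varepsilon^ks_k(z)\equiv 0\pmod{p}. \]
   Context: The large Schröder polynomials are $S_n(z)=\sum_{j=0}^{n}\binom{n}{j}\binom{n+j}{j}\frac{1}{j+1}z^j$ ($n\ge0$); the little Schröder polynomials are $s_0(z)=0$ and $s_n(z)=\sum_{j=1}^{n}\frac{1}{n}\binom{n}{j}\binom{n}{j-1}z^{j-1}(z+1)^{n-j}$ ($n\ge1$). -}

module Defs where

open import Data.Nat as ℕ using (ℕ; zero; suc)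
open import Data.Nat.Combinatorics using (_C_)
open import Data.Integer as ℤ using (ℤ; +_; _+_; _*_; _^_; 0ℤ; 1ℤ)

sumTo : ℕ → (ℕ → ℤ) → ℤ
sumTo zero    f = f 0
sumTo (suc n) f = sumTo n f + f (suc n)

sumFrom1 : ℕ → (ℕ → ℤ) → ℤ
sumFrom1 zero    f = 0ℤ
sumFrom1 (suc n) f = sumFrom1 n f + f (suc n)

-- C(n,j) C(n+j,j) / (j+1)  (an exact division: these are integers)
largeCoeff : ℕ → ℕ → ℕ
largeCoeff n j = ℕ._/_ ((n C j) ℕ.* ((n ℕ.+ j) C j)) (suc j)

S : ℕ → ℤ → ℤ
S n z = sumTo n (λ j → + largeCoeff n j * z ^ j)

-- (1/n) C(n,j) C(n,j-1)  for n = suc m (exact division: Narayana numbers)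
littleCoeff : ℕ → ℕ → ℕ
littleCoeff m j = ℕ._/_ ((suc m C j) ℕ.* (suc m C (j ℕ.∸ 1))) (suc m)

s : ℕ → ℤ → ℤ
s zero    z = 0ℤ
s (suc m) z = sumFrom1 (suc m)
  (λ j → + littleCoeff m j * z ^ (j ℕ.∸ 1) * (z + 1ℤ) ^ (suc m ℕ.∸ j))

-- Write a(n,j) = C(n,j) C(n+j,j), D_n(z) = Σ_j a(n,j) z^j and E_n(z) = Σ_k C(n,k)² z^k (z+1)^(n-k);
-- both are the Legendre polynomial P_n(2z+1). Comparing coefficients gives
--   D_{m+2} - D_m = 2z (2m+3) S_{m+1}(z)   and   E_{m+2} - E_m = 2z(z+1) (2m+3) s_{m+1}(z),
-- so, as ε² = 1, the weighted sums telescope: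
--   2z Σ_{k<p} (2k+1) ε^k S_k(z)      = ε^(p-1) D_p + ε^p D_{p-1} - 1 - ε,
--   2z(z+1) Σ_{k<p} (2k+1) ε^k s_k(z) = ε^(p-1) E_p + ε^p E_{p-1} - 1 - ε - 2z.
-- Modulo p, C(p,j) ≡ 0 for 0 < j < p and C(N,k) ≡ (-1)^k for k < p when p ∣ N+1. With Fermat's little
-- theorem this gives ε^(p-1) ≡ 1, D_p ≡ 1 + C(2p,p) z ≡ 1 + 2z ≡ E_p and D_{p-1} ≡ 1 ≡ E_{p-1}, so the
-- right-hand sides are ≡ 2z and ≡ 0, and 2z and 2z(z+1) are units mod p.

module Submission where

module Binomial where
  open import Data.Nat.Base
  open import Data.Nat.Properties using (m<n⇒m<1+n; ≤-refl; *-identityˡ; *-identityʳ; *-zeroʳ)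
  open import Data.Nat.Combinatorics using (_C_; nCk+nC[k+1]≡[n+1]C[k+1])
  open import Data.Nat.Tactic.RingSolver using (solve-∀)
  open import Relation.Binary.PropositionalEquality

  binomial : ℕ → ℕ → ℕ
  binomial n       zero    = 1
  binomial zero    (suc k) = 0
  binomial (suc n) (suc k) = binomial n k + binomial n (suc k)

  binomial≡C : ∀ n k → binomial n k ≡ n C k
  binomial≡C n       zero    = refl
  binomial≡C zero    (suc k) = refl
  binomial≡C (suc n) (suc k) =
    trans (cong₂ _+_ (binomial≡C n k) (binomial≡C n (suc k))) (nCk+nC[k+1]≡[n+1]C[k+1] n k)

  binomial-above : ∀ {n k} → n < k → binomial n k ≡ 0
  binomial-above {zero}  {suc k} _         = refl
  binomial-above {suc n} {suc k} (s≤s n<k) =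
    cong₂ _+_ (binomial-above n<k) (binomial-above (m<n⇒m<1+n n<k))

  binomial-diag : ∀ n → binomial n n ≡ 1
  binomial-diag zero    = refl
  binomial-diag (suc n) = cong₂ _+_ (binomial-diag n) (binomial-above {n} ≤-refl)

  binomial-1 : ∀ n → binomial n 1 ≡ n
  binomial-1 zero    = refl
  binomial-1 (suc n) = cong suc (binomial-1 n)

  binomial-absorption : ∀ n k → suc k * binomial (suc n) (suc k) ≡ suc n * binomial n k
  binomial-absorption zero    zero    = refl
  binomial-absorption zero    (suc k) = *-zeroʳ (2 + k)
  binomial-absorption (suc n) zero    =
    trans (*-identityˡ _) (trans (binomial-1 (2 + n)) (sym (*-identityʳ (2 + n))))
  binomial-absorption (suc n) (suc k) = begin
    (2 + k) * (x + binomial (suc n) (2 + k))                     ≡⟨ split (suc k) x _ ⟩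
    x + suc k * x + (2 + k) * binomial (suc n) (2 + k)           ≡⟨ cong₂ (λ u v → x + u + v)
                                                                      (binomial-absorption n k)
                                                                      (binomial-absorption n (suc k)) ⟩
    x + suc n * binomial n k + suc n * binomial n (suc k)        ≡⟨ merge (suc n) (binomial n k) _ ⟩
    (2 + n) * x                                                  ∎
    where
    open ≡-Reasoning
    x = binomial (suc n) (suc k)
    split : ∀ c x y → (1 + c) * (x + y) ≡ x + c * x + (1 + c) * y
    split = solve-∀
    merge : ∀ c u v → u + v + c * u + c * v ≡ (1 + c) * (u + v)
    merge = solve-∀

open Binomial

open import Data.Nat.Base as ℕ using (ℕ; zero; suc)
import Data.Nat.Properties as ℕ
import Data.Nat.Divisibility as ℕ∣
open import Data.Nat.DivMod using (m*[n/m]≡n)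
open import Data.Nat.Combinatorics using (_C_)
open import Data.Nat.Primality using (Prime; euclidsLemma; ¬prime[1]; irreducible[2])
open import Data.Integer.Base hiding (suc)
open import Data.Integer.Properties
  using ( pos-*; abs-*; +-comm; +-assoc; +-identityˡ; +-identityʳ; +-inverseʳ; *-assoc; *-identityˡ; *-identityʳ
        ; *-zeroʳ; *-distribˡ-+; *-distribʳ-+; *-cancelˡ-≡; ^-zeroˡ)
import Data.Integer.Divisibility.Signed as ℤ∣
open import Data.Integer.GCD using (gcd; gcd-greatest)
open import Data.Integer.Tactic.RingSolver using (solve-∀)
open import Data.Product using (_×_; _,_; proj₁; proj₂)
open import Data.Sum as Sum using (_⊎_; inj₁; inj₂)
open import Data.Empty using (⊥-elim)
open import Function using (_∘_; id)
open import Level using (0ℓ)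
open import Relation.Nullary using (¬_)
open import Relation.Binary.Bundles using (Setoid)
open import Relation.Binary.Structures using (IsEquivalence)
open import Relation.Binary.PropositionalEquality
  using (_≡_; _≢_; refl; sym; trans; cong; cong₂; subst; module ≡-Reasoning)
import Relation.Binary.Reasoning.Setoid as SetoidReasoning
open import Defs

C[_,_] : ℕ → ℕ → ℤ
C[ n , k ] = + binomial n k

C[n,1]≡n : ∀ n → C[ n , 1 ] ≡ + n
C[n,1]≡n n = cong +_ (binomial-1 n)

[1+k]C[1+n,1+k]≡[1+n]C[n,k] : ∀ n k → + suc k * C[ suc n , suc k ] ≡ + suc n * C[ n , k ]
[1+k]C[1+n,1+k]≡[1+n]C[n,k] n k =
  trans (sym (pos-* (suc k) _)) (trans (cong +_ (binomial-absorption n k)) (pos-* (suc n) _))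

[1+k]C[n,1+k]≡[n-k]C[n,k] : ∀ n k → + suc k * C[ n , suc k ] ≡ (+ n - + k) * C[ n , k ]
[1+k]C[n,1+k]≡[n-k]C[n,k] n k = begin
  + suc k * y                                       ≡⟨ unpascal (+ k) C[ n , k ] y ⟩
  + suc k * (C[ n , k ] + y) - + suc k * C[ n , k ] ≡⟨ cong (_- + suc k * C[ n , k ]) absorb ⟩
  + suc n * C[ n , k ] - + suc k * C[ n , k ]       ≡⟨ collect (+ n) (+ k) C[ n , k ] ⟩
  (+ n - + k) * C[ n , k ]                          ∎
  where
  open ≡-Reasoning
  y = C[ n , suc k ]
  absorb : + suc k * (C[ n , k ] + y) ≡ + suc n * C[ n , k ]
  absorb = [1+k]C[1+n,1+k]≡[1+n]C[n,k] n k
  unpascal : ∀ k x y → (1ℤ + k) * y ≡ (1ℤ + k) * (x + y) - (1ℤ + k) * x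
  unpascal = solve-∀
  collect : ∀ n k x → (1ℤ + n) * x - (1ℤ + k) * x ≡ (n - k) * x
  collect = solve-∀

[1+n-k]C[1+n,k]≡[1+n]C[n,k] : ∀ n k → (+ suc n - + k) * C[ suc n , k ] ≡ + suc n * C[ n , k ]
[1+n-k]C[1+n,k]≡[1+n]C[n,k] n zero    = cong (_* 1ℤ) (+-identityʳ (+ suc n))
[1+n-k]C[1+n,k]≡[1+n]C[n,k] n (suc k) = begin
  (+ suc n - + suc k) * (C[ n , k ] + C[ n , suc k ])            ≡⟨ expand (+ n) (+ k) C[ n , k ] C[ n , suc k ] ⟩
  (+ n - + k) * C[ n , k ] + (+ n - + k) * C[ n , suc k ]       ≡⟨ cong (_+ (+ n - + k) * C[ n , suc k ])
                                                                     (sym ([1+k]C[n,1+k]≡[n-k]C[n,k] n k)) ⟩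
  + suc k * C[ n , suc k ] + (+ n - + k) * C[ n , suc k ]        ≡⟨ collect (+ n) (+ k) C[ n , suc k ] ⟩
  + suc n * C[ n , suc k ]                                       ∎
  where
  open ≡-Reasoning
  expand : ∀ n k x y → ((1ℤ + n) - (1ℤ + k)) * (x + y) ≡ (n - k) * x + (n - k) * y
  expand = solve-∀
  collect : ∀ n k y → (1ℤ + k) * y + (n - k) * y ≡ (1ℤ + n) * y
  collect = solve-∀

C[2n,n]≡2C[2n-1,n-1] : ∀ n → C[ suc n ℕ.+ suc n , suc n ] ≡ + 2 * C[ suc n ℕ.+ n , n ]
C[2n,n]≡2C[2n-1,n-1] n = *-cancelˡ-≡ (+ suc n) _ _ (begin
  + suc n * C[ suc n ℕ.+ suc n , suc n ]  ≡⟨ cong (λ t → + suc n * C[ suc t , suc n ]) (ℕ.+-suc n n) ⟩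
  + suc n * C[ suc (suc n ℕ.+ n) , suc n ] ≡⟨ [1+k]C[1+n,1+k]≡[1+n]C[n,k] (suc n ℕ.+ n) n ⟩
  + suc (suc n ℕ.+ n) * C[ suc n ℕ.+ n , n ] ≡⟨ double (+ n) C[ suc n ℕ.+ n , n ] ⟩
  + suc n * (+ 2 * C[ suc n ℕ.+ n , n ])  ∎)
  where
  open ≡-Reasoning
  double : ∀ n c → (1ℤ + ((1ℤ + n) + n)) * c ≡ (1ℤ + n) * (+ 2 * c)
  double = solve-∀

-- Finite sums

sumTo-cong : ∀ n {f g : ℕ → ℤ} → (∀ j → j ℕ.≤ n → f j ≡ g j) → sumTo n f ≡ sumTo n g
sumTo-cong zero    f≡g = f≡g 0 ℕ.z≤n
sumTo-cong (suc n) f≡g =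
  cong₂ _+_ (sumTo-cong n (λ j j≤n → f≡g j (ℕ.m≤n⇒m≤1+n j≤n))) (f≡g (suc n) ℕ.≤-refl)

sumTo-+ : ∀ n (f g : ℕ → ℤ) → sumTo n (λ j → f j + g j) ≡ sumTo n f + sumTo n g
sumTo-+ zero    f g = refl
sumTo-+ (suc n) f g =
  trans (cong (_+ (f (suc n) + g (suc n))) (sumTo-+ n f g)) (interchange (sumTo n f) (sumTo n g) (f (suc n)) (g (suc n)))
  where
  interchange : ∀ a b c d → a + b + (c + d) ≡ a + c + (b + d)
  interchange = solve-∀

sumTo-- : ∀ n (f g : ℕ → ℤ) → sumTo n (λ j → f j - g j) ≡ sumTo n f - sumTo n g
sumTo-- zero    f g = refl
sumTo-- (suc n) f g =
  trans (cong (_+ (f (suc n) - g (suc n))) (sumTo-- n f g)) (interchange (sumTo n f) (sumTo n g) (f (suc n)) (g (suc n)))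
  where
  interchange : ∀ a b c d → a - b + (c - d) ≡ a + c - (b + d)
  interchange = solve-∀

*-sumTo : ∀ n c (f : ℕ → ℤ) → sumTo n (λ j → c * f j) ≡ c * sumTo n f
*-sumTo zero    c f = refl
*-sumTo (suc n) c f = trans (cong (_+ c * f (suc n)) (*-sumTo n c f)) (sym (*-distribˡ-+ c _ _))

sumTo-suc : ∀ n (f : ℕ → ℤ) → sumTo (suc n) f ≡ f 0 + sumTo n (λ j → f (suc j))
sumTo-suc zero    f = refl
sumTo-suc (suc n) f = trans (cong (_+ f (suc (suc n))) (sumTo-suc n f)) (+-assoc (f 0) _ _)

sumTo-pad : ∀ k n (f : ℕ → ℤ) → (∀ j → n ℕ.< j → f j ≡ 0ℤ) → sumTo (k ℕ.+ n) f ≡ sumTo n f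
sumTo-pad zero    n f f≡0 = refl
sumTo-pad (suc k) n f f≡0 = begin
  sumTo (k ℕ.+ n) f + f (suc (k ℕ.+ n)) ≡⟨ cong₂ _+_ (sumTo-pad k n f f≡0) (f≡0 _ (ℕ.s≤s (ℕ.m≤n+m n k))) ⟩
  sumTo n f + 0ℤ                        ≡⟨ +-identityʳ _ ⟩
  sumTo n f                             ∎
  where open ≡-Reasoning

sumFrom1-suc : ∀ n (f : ℕ → ℤ) → sumFrom1 (suc n) f ≡ sumTo n (λ j → f (suc j))
sumFrom1-suc zero    f = +-identityˡ (f 1)
sumFrom1-suc (suc n) f = cong (_+ f (suc (suc n))) (sumFrom1-suc n f)

homSum : ℕ → (ℕ → ℤ) → ℤ → ℤ → ℤ
homSum n c x y = sumTo n (λ k → c k * x ^ k * y ^ (n ℕ.∸ k))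

shift : (ℕ → ℤ) → ℕ → ℤ
shift c zero    = 0ℤ
shift c (suc k) = c k

homSum-cong : ∀ n {c d : ℕ → ℤ} x y → (∀ k → c k ≡ d k) → homSum n c x y ≡ homSum n d x y
homSum-cong n x y c≡d = sumTo-cong n (λ k _ → cong (λ t → t * x ^ k * y ^ (n ℕ.∸ k)) (c≡d k))

homSum-+ : ∀ n (c d : ℕ → ℤ) x y → homSum n (λ k → c k + d k) x y ≡ homSum n c x y + homSum n d x y
homSum-+ n c d x y = trans (sumTo-cong n (λ k _ → distrib (c k) (d k) _ _)) (sumTo-+ n _ _)
  where
  distrib : ∀ a b u v → (a + b) * u * v ≡ a * u * v + b * u * v
  distrib = solve-∀

homSum-- : ∀ n (c d : ℕ → ℤ) x y → homSum n (λ k → c k - d k) x y ≡ homSum n c x y - homSum n d x y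
homSum-- n c d x y = trans (sumTo-cong n (λ k _ → distrib (c k) (d k) _ _)) (sumTo-- n _ _)
  where
  distrib : ∀ a b u v → (a - b) * u * v ≡ a * u * v - b * u * v
  distrib = solve-∀

homSum-* : ∀ n a (c : ℕ → ℤ) x y → homSum n (λ k → a * c k) x y ≡ a * homSum n c x y
homSum-* n a c x y = trans (sumTo-cong n (λ k _ → *-assoc³ a (c k) _ _)) (*-sumTo n a _)
  where
  *-assoc³ : ∀ a b u v → a * b * u * v ≡ a * (b * u * v)
  *-assoc³ = solve-∀

homSum-suc : ∀ n c x y → homSum (suc n) c x y ≡ c 0 * 1ℤ * y ^ suc n + x * homSum n (λ k → c (suc k)) x y
homSum-suc n c x y = begin
  homSum (suc n) c x y
    ≡⟨ sumTo-suc n _ ⟩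
  c 0 * 1ℤ * y ^ suc n + sumTo n (λ k → c (suc k) * (x * x ^ k) * y ^ (n ℕ.∸ k))
    ≡⟨ cong (λ t → c 0 * 1ℤ * y ^ suc n + t) (sumTo-cong n (λ k _ → pull (c (suc k)) x _ _)) ⟩
  c 0 * 1ℤ * y ^ suc n + sumTo n (λ k → x * (c (suc k) * x ^ k * y ^ (n ℕ.∸ k)))
    ≡⟨ cong (λ t → c 0 * 1ℤ * y ^ suc n + t) (*-sumTo n x _) ⟩
  c 0 * 1ℤ * y ^ suc n + x * homSum n (λ k → c (suc k)) x y ∎
  where
  open ≡-Reasoning
  pull : ∀ a x u v → a * (x * u) * v ≡ x * (a * u * v)
  pull = solve-∀

homSum-shift : ∀ n c x y → homSum (suc n) (shift c) x y ≡ x * homSum n c x y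
homSum-shift n c x y = trans (homSum-suc n (shift c) x y) (+-identityˡ _)

homSum-pad : ∀ n c x y → c (suc n) ≡ 0ℤ → homSum (suc n) c x y ≡ y * homSum n c x y
homSum-pad n c x y top≡0 = begin
  sumTo n (λ k → c k * x ^ k * y ^ (suc n ℕ.∸ k)) + c (suc n) * x ^ suc n * y ^ (n ℕ.∸ n)
    ≡⟨ cong₂ _+_ (sumTo-cong n (λ k k≤n → trans (cong (λ e → c k * x ^ k * y ^ e) (ℕ.+-∸-assoc 1 k≤n))
                                                 (pull (c k) (x ^ k) y _)))
                 (cong (λ t → t * x ^ suc n * y ^ (n ℕ.∸ n)) top≡0) ⟩
  sumTo n (λ k → y * (c k * x ^ k * y ^ (n ℕ.∸ k))) + 0ℤ
    ≡⟨ +-identityʳ _ ⟩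
  sumTo n (λ k → y * (c k * x ^ k * y ^ (n ℕ.∸ k)))
    ≡⟨ *-sumTo n y _ ⟩
  y * homSum n c x y ∎
  where
  open ≡-Reasoning
  pull : ∀ a u y v → a * u * (y * v) ≡ y * (a * u * v)
  pull = solve-∀

-- Since (x + 1) - x = 1, multiplying by its square raises the degree by two.
homSum-raise : ∀ n c x → c (suc n) ≡ 0ℤ → c (suc (suc n)) ≡ 0ℤ →
  homSum n c x (x + 1ℤ) ≡
  homSum (suc (suc n)) c x (x + 1ℤ) - + 2 * homSum (suc (suc n)) (shift c) x (x + 1ℤ)
    + homSum (suc (suc n)) (shift (shift c)) x (x + 1ℤ)
homSum-raise n c x c₁≡0 c₂≡0 = begin
  h                                                    ≡⟨ square x h ⟩
  y * (y * h) - + 2 * (x * (y * h)) + x * (x * h)     ≡⟨ cong₂ (λ s t → y * s - + 2 * (x * s) + x * t)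
                                                            (sym (homSum-pad n c x y c₁≡0)) (sym (homSum-shift n c x y)) ⟩
  y * h₁ - + 2 * (x * h₁) + x * h₁′                    ≡⟨ cong₂ (λ s t → s - + 2 * t + x * h₁′)
                                                            (sym (homSum-pad (suc n) c x y c₂≡0))
                                                            (sym (homSum-shift (suc n) c x y)) ⟩
  H₀ - + 2 * H₁ + x * h₁′                              ≡⟨ cong (λ t → H₀ - + 2 * H₁ + t)
                                                            (sym (homSum-shift (suc n) (shift c) x y)) ⟩
  H₀ - + 2 * H₁ + H₂                                   ∎
  where
  open ≡-Reasoning
  y = x + 1ℤ
  h = homSum n c x y
  h₁ = homSum (suc n) c x y
  h₁′ = homSum (suc n) (shift c) x y
  H₀ = homSum (suc (suc n)) c x y
  H₁ = homSum (suc (suc n)) (shift c) x y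
  H₂ = homSum (suc (suc n)) (shift (shift c)) x y
  square : ∀ x h → h ≡ (x + 1ℤ) * ((x + 1ℤ) * h) - + 2 * (x * ((x + 1ℤ) * h)) + x * (x * h)
  square = solve-∀

binomial-theorem : ∀ n x y → (x + y) ^ n ≡ homSum n (λ k → C[ n , k ]) x y
binomial-theorem zero    x y = refl
binomial-theorem (suc n) x y = begin
  (x + y) * (x + y) ^ n                                   ≡⟨ cong ((x + y) *_) (binomial-theorem n x y) ⟩
  (x + y) * h                                             ≡⟨ *-distribʳ-+ h x y ⟩
  x * h + y * h                                           ≡⟨ cong₂ _+_ (sym (homSum-shift n C[ n ,_] x y))
                                                               (sym (homSum-pad n C[ n ,_] x y (cong +_ (binomial-above {n} ℕ.≤-refl)))) ⟩
  homSum (suc n) (shift C[ n ,_]) x y + homSum (suc n) C[ n ,_] x y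
                                                          ≡⟨ sym (homSum-+ (suc n) (shift C[ n ,_]) C[ n ,_] x y) ⟩
  homSum (suc n) (λ k → shift C[ n ,_] k + C[ n , k ]) x y ≡⟨ homSum-cong (suc n) x y pascal ⟩
  homSum (suc n) C[ suc n ,_] x y                         ∎
  where
  open ≡-Reasoning
  h = homSum n C[ n ,_] x y
  pascal : ∀ k → shift C[ n ,_] k + C[ n , k ] ≡ C[ suc n , k ]
  pascal zero    = refl
  pascal (suc k) = refl

homSum-geometric : ∀ n x y → (y - x) * homSum n (λ _ → 1ℤ) x y ≡ y ^ suc n - x ^ suc n
homSum-geometric zero    x y = base x y
  where
  base : ∀ x y → (y - x) * 1ℤ ≡ y * 1ℤ - x * 1ℤ
  base = solve-∀
homSum-geometric (suc n) x y = begin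
  (y - x) * homSum (suc n) (λ _ → 1ℤ) x y              ≡⟨ cong ((y - x) *_) (homSum-suc n (λ _ → 1ℤ) x y) ⟩
  (y - x) * (1ℤ * 1ℤ * y ^ suc n + x * h)              ≡⟨ expand x y (y ^ suc n) h ⟩
  (y - x) * y ^ suc n + x * ((y - x) * h)              ≡⟨ cong (λ t → (y - x) * y ^ suc n + x * t) (homSum-geometric n x y) ⟩
  (y - x) * y ^ suc n + x * (y ^ suc n - x ^ suc n)    ≡⟨ collect x y (y ^ suc n) (x ^ suc n) ⟩
  y ^ suc (suc n) - x ^ suc (suc n)                    ∎
  where
  open ≡-Reasoning
  h = homSum n (λ _ → 1ℤ) x y
  expand : ∀ x y Y h → (y - x) * (1ℤ * 1ℤ * Y + x * h) ≡ (y - x) * Y + x * ((y - x) * h)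
  expand = solve-∀
  collect : ∀ x y Y X → (y - x) * Y + x * (Y - X) ≡ y * Y - x * X
  collect = solve-∀

-- Coefficient identities

exact-quotient : ∀ d m → suc d ℕ∣.∣ m → + suc d * + (m ℕ./ suc d) ≡ + m
exact-quotient d m d∣m = trans (sym (pos-* (suc d) _)) (cong +_ (m*[n/m]≡n d∣m))

legendreCoeff : ℕ → ℕ → ℤ
legendreCoeff n j = C[ n , j ] * C[ n ℕ.+ j , j ]

1+j∣C[n,j]C[n+j,j] : ∀ n j → suc j ℕ∣.∣ binomial n j ℕ.* binomial (n ℕ.+ j) j
1+j∣C[n,j]C[n+j,j] n j =
  ℤ∣.∣⇒∣ᵤ (subst (+ suc j ℤ∣.∣_) (sym (pos-* (binomial n j) _)) (ℤ∣.divides (x * y + a * y - x * b) factorisation))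
  where
  open ≡-Reasoning
  x = C[ n , j ]
  y = C[ n ℕ.+ j , j ]
  a = C[ suc n , suc j ]
  b = C[ suc (n ℕ.+ j) , suc j ]
  split : ∀ n j x y → x * y ≡ (1ℤ + j) * (x * y) + (1ℤ + n) * x * y - x * ((1ℤ + (n + j)) * y)
  split = solve-∀
  collect : ∀ j x y a b → (1ℤ + j) * (x * y) + (1ℤ + j) * a * y - x * ((1ℤ + j) * b)
                          ≡ (x * y + a * y - x * b) * (1ℤ + j)
  collect = solve-∀
  factorisation : x * y ≡ (x * y + a * y - x * b) * + suc j
  factorisation = begin
    x * y                                                    ≡⟨ split (+ n) (+ j) x y ⟩
    + suc j * (x * y) + + suc n * x * y - x * (+ suc (n ℕ.+ j) * y)
      ≡⟨ cong₂ (λ u v → + suc j * (x * y) + u * y - x * v)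
           (sym ([1+k]C[1+n,1+k]≡[1+n]C[n,k] n j)) (sym ([1+k]C[1+n,1+k]≡[1+n]C[n,k] (n ℕ.+ j) j)) ⟩
    + suc j * (x * y) + + suc j * a * y - x * (+ suc j * b)   ≡⟨ collect (+ j) x y a b ⟩
    (x * y + a * y - x * b) * + suc j                         ∎

[1+j]largeCoeff≡legendreCoeff : ∀ n j → + suc j * + largeCoeff n j ≡ legendreCoeff n j
[1+j]largeCoeff≡legendreCoeff n j =
  subst (λ c → + suc j * + (c ℕ./ suc j) ≡ legendreCoeff n j)
    (cong₂ ℕ._*_ (binomial≡C n j) (binomial≡C (n ℕ.+ j) j))
    (trans (exact-quotient j _ (1+j∣C[n,j]C[n+j,j] n j)) (pos-* (binomial n j) _))

-- The instance used has x = C(m+1,j), y = C(m+1+j,j), a₁a₂ = a(m+2,j+1) and a₃a₄ = a(m,j+1),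
-- where a = legendreCoeff; the hypotheses are the ratios between neighbouring binomial coefficients.
legendreCoeff-difference-identity : ∀ m j x y w u a₁ a₂ a₃ a₄ →
  + suc j * a₁ ≡ + suc (suc m) * x →
  + suc j * a₂ ≡ + suc (suc (suc (m ℕ.+ j))) * w →
  (+ suc (suc (m ℕ.+ j)) - + j) * w ≡ + suc (suc (m ℕ.+ j)) * y →
  (+ suc m - + suc j) * u ≡ + suc m * a₃ →
  + suc j * u ≡ (+ suc m - + j) * x →
  + suc j * a₄ ≡ (+ suc (m ℕ.+ j) - + j) * y →
  + suc j * (a₁ * a₂ - a₃ * a₄) ≡ + 2 * (+ 2 * + suc m + 1ℤ) * (x * y)
legendreCoeff-difference-identity m j x y w u a₁ a₂ a₃ a₄ h₁ h₂ h₃ h₄ h₅ h₆ = *-cancelˡ-≡ (n * k) _ _ (begin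
  n * k * (k * (a₁ * a₂ - a₃ * a₄))                                   ≡⟨ expand n k a₁ a₂ a₃ a₄ ⟩
  n * ((k * a₁) * (k * a₂)) - k * ((n * a₃) * (k * a₄))              ≡⟨ cong₂ (λ s t → n * s - k * t)
                                                                          (cong₂ _*_ h₁ h₂) (cong₂ _*_ (sym h₄) h₆) ⟩
  n * ((n₁ * x) * (r₂ * w)) - k * (((n - k) * u) * ((r₀ - + j) * y))   ≡⟨ regroup (+ m) (+ j) x y w u ⟩
  n * r₂ * x * ((r₁ - + j) * w) - (n - k) * (k * u) * ((r₀ - + j) * y) ≡⟨ cong₂ (λ s t → n * r₂ * x * s - (n - k) * t * ((r₀ - + j) * y))
                                                                               h₃ h₅ ⟩
  n * r₂ * x * (r₁ * y) - (n - k) * ((n - + j) * x) * ((r₀ - + j) * y) ≡⟨ collect (+ m) (+ j) x y ⟩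
  n * k * (+ 2 * (+ 2 * n + 1ℤ) * (x * y))                            ∎)
  where
  open ≡-Reasoning
  n = + suc m
  k = + suc j
  n₁ = + suc (suc m)
  r₀ = + suc (m ℕ.+ j)
  r₁ = + suc (suc (m ℕ.+ j))
  r₂ = + suc (suc (suc (m ℕ.+ j)))
  expand : ∀ n k a₁ a₂ a₃ a₄ →
    n * k * (k * (a₁ * a₂ - a₃ * a₄)) ≡ n * ((k * a₁) * (k * a₂)) - k * ((n * a₃) * (k * a₄))
  expand = solve-∀
  regroup : ∀ m j x y w u →
    (1ℤ + m) * (((1ℤ + (1ℤ + m)) * x) * ((1ℤ + (1ℤ + (1ℤ + (m + j)))) * w))
      - (1ℤ + j) * ((((1ℤ + m) - (1ℤ + j)) * u) * (((1ℤ + (m + j)) - j) * y))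
    ≡ (1ℤ + m) * (1ℤ + (1ℤ + (1ℤ + (m + j)))) * x * (((1ℤ + (1ℤ + (m + j))) - j) * w)
      - ((1ℤ + m) - (1ℤ + j)) * ((1ℤ + j) * u) * (((1ℤ + (m + j)) - j) * y)
  regroup = solve-∀
  collect : ∀ m j x y →
    (1ℤ + m) * (1ℤ + (1ℤ + (1ℤ + (m + j)))) * x * ((1ℤ + (1ℤ + (m + j))) * y)
      - ((1ℤ + m) - (1ℤ + j)) * (((1ℤ + m) - j) * x) * (((1ℤ + (m + j)) - j) * y)
    ≡ (1ℤ + m) * (1ℤ + j) * (+ 2 * (+ 2 * (1ℤ + m) + 1ℤ) * (x * y))
  collect = solve-∀

legendreCoeff-step : ∀ m j →
  legendreCoeff (suc (suc m)) (suc j) - legendreCoeff m (suc j) ≡ + 2 * (+ 2 * + suc m + 1ℤ) * + largeCoeff (suc m) j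
legendreCoeff-step m j = *-cancelˡ-≡ (+ suc j) _ _ (begin
  + suc j * (legendreCoeff (suc (suc m)) (suc j) - legendreCoeff m (suc j))
    ≡⟨ cong (λ t → + suc j * (C[ suc n , suc j ] * C[ suc (suc t) , suc j ] - C[ m , suc j ] * C[ t , suc j ])) (ℕ.+-suc m j) ⟩
  + suc j * (C[ suc n , suc j ] * C[ suc (suc (n ℕ.+ j)) , suc j ] - C[ m , suc j ] * C[ n ℕ.+ j , suc j ])
    ≡⟨ legendreCoeff-difference-identity m j _ _ C[ suc (n ℕ.+ j) , j ] C[ n , suc j ] _ _ _ _
         ([1+k]C[1+n,1+k]≡[1+n]C[n,k] n j) ([1+k]C[1+n,1+k]≡[1+n]C[n,k] (suc (n ℕ.+ j)) j)
         ([1+n-k]C[1+n,k]≡[1+n]C[n,k] (n ℕ.+ j) j) ([1+n-k]C[1+n,k]≡[1+n]C[n,k] m (suc j))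
         ([1+k]C[n,1+k]≡[n-k]C[n,k] n j) ([1+k]C[n,1+k]≡[n-k]C[n,k] (n ℕ.+ j) j) ⟩
  c * legendreCoeff n j
    ≡⟨ cong (c *_) (sym ([1+j]largeCoeff≡legendreCoeff n j)) ⟩
  c * (+ suc j * + largeCoeff n j)
    ≡⟨ swap c (+ suc j) _ ⟩
  + suc j * (c * + largeCoeff n j) ∎)
  where
  open ≡-Reasoning
  n = suc m
  c = + 2 * (+ 2 * + n + 1ℤ)
  swap : ∀ a b t → a * (b * t) ≡ b * (a * t)
  swap = solve-∀

1+m∣C[1+m,1+i]C[1+m,i] : ∀ m i → suc m ℕ∣.∣ binomial (suc m) (suc i) ℕ.* binomial (suc m) i
1+m∣C[1+m,1+i]C[1+m,i] m i =
  ℤ∣.∣⇒∣ᵤ (subst (+ suc m ℤ∣.∣_) (sym (pos-* (binomial (suc m) (suc i)) _)) (ℤ∣.divides (w * (y + z) - z * y) factorisation))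
  where
  open ≡-Reasoning
  w = C[ m , i ]
  y = C[ suc m , i ]
  z = C[ suc m , suc i ]
  split : ∀ m z y → z * y ≡ z * ((1ℤ + (1ℤ + m)) * y) - (1ℤ + m) * (z * y)
  split = solve-∀
  regroup : ∀ i y z r → z * ((1ℤ + i) * (y + z)) - r ≡ (y + z) * ((1ℤ + i) * z) - r
  regroup = solve-∀
  collect : ∀ m w y z → (y + z) * ((1ℤ + m) * w) - (1ℤ + m) * (z * y) ≡ (w * (y + z) - z * y) * (1ℤ + m)
  collect = solve-∀
  factorisation : z * y ≡ (w * (y + z) - z * y) * + suc m
  factorisation = begin
    z * y                                          ≡⟨ split (+ m) z y ⟩
    z * (+ suc (suc m) * y) - + suc m * (z * y)    ≡⟨ cong (λ t → z * t - + suc m * (z * y))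
                                                        (sym ([1+k]C[1+n,1+k]≡[1+n]C[n,k] (suc m) i)) ⟩
    z * (+ suc i * (y + z)) - + suc m * (z * y)    ≡⟨ regroup (+ i) y z (+ suc m * (z * y)) ⟩
    (y + z) * (+ suc i * z) - + suc m * (z * y)    ≡⟨ cong (λ t → (y + z) * t - + suc m * (z * y))
                                                        ([1+k]C[1+n,1+k]≡[1+n]C[n,k] m i) ⟩
    (y + z) * (+ suc m * w) - + suc m * (z * y)    ≡⟨ collect (+ m) w y z ⟩
    (w * (y + z) - z * y) * + suc m                ∎

[1+m]littleCoeff≡C[1+m,1+i]C[1+m,i] : ∀ m i → + suc m * + littleCoeff m (suc i) ≡ C[ suc m , suc i ] * C[ suc m , i ]
[1+m]littleCoeff≡C[1+m,1+i]C[1+m,i] m i =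
  subst (λ c → + suc m * + (c ℕ./ suc m) ≡ C[ suc m , suc i ] * C[ suc m , i ])
    (cong₂ ℕ._*_ (binomial≡C (suc m) (suc i)) (binomial≡C (suc m) i))
    (trans (exact-quotient m _ (1+m∣C[1+m,1+i]C[1+m,i] m i)) (pos-* (binomial (suc m) (suc i)) _))

squareCoeff : ℕ → ℕ → ℤ
squareCoeff n k = C[ n , k ] * C[ n , k ]

narayanaCoeff : ℕ → ℕ → ℤ
narayanaCoeff m i = + littleCoeff m (suc i)

-- The instance used has x, y, w = C(m,i), C(m,i+1), C(m,i+2) and l = littleCoeff m (i+2); the right-hand side
-- is C(m+2,i+2)² - C(m,i+2)² + 2 C(m,i+1)² - C(m,i)².
narayana-identity : ∀ m i x y w l →
  + suc m * l ≡ (y + w) * (x + y) →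
  + suc i * y ≡ (+ m - + i) * x →
  + suc (suc i) * w ≡ (+ m - + suc i) * y →
  + 2 * (+ 2 * + suc m + 1ℤ) * l ≡ (x + y + (y + w)) * (x + y + (y + w)) - w * w + + 2 * (y * y) - x * x
narayana-identity m i x y w l h₀ h₁ h₂ = *-cancelˡ-≡ (+ suc m * + suc (suc i)) _ _ (begin
  + suc m * + suc (suc i) * (c * l)
    ≡⟨ regroup (+ suc m) (+ suc (suc i)) c l ⟩
  + suc (suc i) * c * (+ suc m * l)
    ≡⟨ cong (+ suc (suc i) * c *_) h₀ ⟩
  + suc (suc i) * c * ((y + w) * (x + y))
    ≡⟨ certificate (+ m) (+ i) x y w ⟩
  + suc m * + suc (suc i) * rhs
    - + 2 * + suc m * y * (+ suc i * y - (+ m - + i) * x)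
    + + 2 * (y + + suc (suc m) * x) * (+ suc (suc i) * w - (+ m - + suc i) * y)
    ≡⟨ cong₂ (λ s t → + suc m * + suc (suc i) * rhs - + 2 * + suc m * y * (s - (+ m - + i) * x)
                       + + 2 * (y + + suc (suc m) * x) * (t - (+ m - + suc i) * y)) h₁ h₂ ⟩
  + suc m * + suc (suc i) * rhs
    - + 2 * + suc m * y * ((+ m - + i) * x - (+ m - + i) * x)
    + + 2 * (y + + suc (suc m) * x) * ((+ m - + suc i) * y - (+ m - + suc i) * y)
    ≡⟨ cancel (+ suc m * + suc (suc i) * rhs) (+ 2 * + suc m * y) (+ 2 * (y + + suc (suc m) * x))
              ((+ m - + i) * x) ((+ m - + suc i) * y) ⟩
  + suc m * + suc (suc i) * rhs ∎)
  where
  open ≡-Reasoning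
  c = + 2 * (+ 2 * + suc m + 1ℤ)
  rhs = (x + y + (y + w)) * (x + y + (y + w)) - w * w + + 2 * (y * y) - x * x
  regroup : ∀ a b c l → a * b * (c * l) ≡ b * c * (a * l)
  regroup = solve-∀
  certificate : ∀ m i x y w →
    (1ℤ + (1ℤ + i)) * (+ 2 * (+ 2 * (1ℤ + m) + 1ℤ)) * ((y + w) * (x + y))
    ≡ (1ℤ + m) * (1ℤ + (1ℤ + i)) * ((x + y + (y + w)) * (x + y + (y + w)) - w * w + + 2 * (y * y) - x * x)
      - + 2 * (1ℤ + m) * y * ((1ℤ + i) * y - (m - i) * x)
      + + 2 * (y + (1ℤ + (1ℤ + m)) * x) * ((1ℤ + (1ℤ + i)) * w - (m - (1ℤ + i)) * y)
  certificate = solve-∀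
  cancel : ∀ r a b s t → r - a * (s - s) + b * (t - t) ≡ r
  cancel = solve-∀

littleCoeff-step : ∀ m k →
  + 2 * (+ 2 * + suc m + 1ℤ) * shift (narayanaCoeff m) k
  ≡ squareCoeff (suc (suc m)) k - squareCoeff m k + + 2 * shift (squareCoeff m) k - shift (shift (squareCoeff m)) k
littleCoeff-step m zero = *-zeroʳ (+ 2 * (+ 2 * + suc m + 1ℤ))
littleCoeff-step m (suc zero) = begin
  c * + littleCoeff m 1                                               ≡⟨ cong (c *_) narayana₁ ⟩
  c * 1ℤ                                                              ≡⟨ expand (+ m) ⟩
  (+ 2 + + m) * (+ 2 + + m) - + m * + m + + 2 * 1ℤ - 0ℤ                ≡⟨ cong₂ (λ s t → s * s - t * t + + 2 * 1ℤ - 0ℤ)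
                                                                           (sym (C[n,1]≡n (suc (suc m)))) (sym (C[n,1]≡n m)) ⟩
  C[ suc (suc m) , 1 ] * C[ suc (suc m) , 1 ] - C[ m , 1 ] * C[ m , 1 ] + + 2 * 1ℤ - 0ℤ ∎
  where
  open ≡-Reasoning
  c = + 2 * (+ 2 * + suc m + 1ℤ)
  narayana₁ : + littleCoeff m 1 ≡ 1ℤ
  narayana₁ = *-cancelˡ-≡ (+ suc m) _ _
    (trans ([1+m]littleCoeff≡C[1+m,1+i]C[1+m,i] m 0) (cong (_* 1ℤ) (C[n,1]≡n (suc m))))
  expand : ∀ m → + 2 * (+ 2 * (1ℤ + m) + 1ℤ) * 1ℤ ≡ (+ 2 + m) * (+ 2 + m) - m * m + + 2 * 1ℤ - 0ℤ
  expand = solve-∀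
littleCoeff-step m (suc (suc i)) =
  narayana-identity m i C[ m , i ] C[ m , suc i ] C[ m , suc (suc i) ] (+ littleCoeff m (suc (suc i)))
    ([1+m]littleCoeff≡C[1+m,1+i]C[1+m,i] m (suc i)) ([1+k]C[n,1+k]≡[n-k]C[n,k] m i) ([1+k]C[n,1+k]≡[n-k]C[n,k] m (suc i))

-- Legendre polynomials

legendreSum : ℕ → ℤ → ℤ
legendreSum n z = sumTo n (λ j → legendreCoeff n j * z ^ j)

legendreSum-step : ∀ m z →
  legendreSum (suc (suc m)) z - legendreSum m z ≡ + 2 * z * ((+ 2 * + suc m + 1ℤ) * S (suc m) z)
legendreSum-step m z = begin
  legendreSum (suc (suc m)) z - legendreSum m z
    ≡⟨ cong (λ t → legendreSum (suc (suc m)) z - t) (sym (sumTo-pad 2 m (λ j → legendreCoeff m j * z ^ j) vanish)) ⟩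
  sumTo (suc (suc m)) (λ j → legendreCoeff (suc (suc m)) j * z ^ j) - sumTo (suc (suc m)) (λ j → legendreCoeff m j * z ^ j)
    ≡⟨ sym (sumTo-- (suc (suc m)) _ _) ⟩
  sumTo (suc (suc m)) (λ j → legendreCoeff (suc (suc m)) j * z ^ j - legendreCoeff m j * z ^ j)
    ≡⟨ sumTo-suc (suc m) _ ⟩
  0ℤ + sumTo (suc m) (λ j → legendreCoeff (suc (suc m)) (suc j) * z ^ suc j - legendreCoeff m (suc j) * z ^ suc j)
    ≡⟨ +-identityˡ _ ⟩
  sumTo (suc m) (λ j → legendreCoeff (suc (suc m)) (suc j) * z ^ suc j - legendreCoeff m (suc j) * z ^ suc j)
    ≡⟨ sumTo-cong (suc m) (λ j _ → termwise j) ⟩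
  sumTo (suc m) (λ j → w * (+ largeCoeff (suc m) j * z ^ j))
    ≡⟨ *-sumTo (suc m) w _ ⟩
  w * S (suc m) z
    ≡⟨ *-assoc (+ 2 * z) _ _ ⟩
  + 2 * z * ((+ 2 * + suc m + 1ℤ) * S (suc m) z) ∎
  where
  open ≡-Reasoning
  w = + 2 * z * (+ 2 * + suc m + 1ℤ)
  vanish : ∀ j → m ℕ.< j → legendreCoeff m j * z ^ j ≡ 0ℤ
  vanish j m<j = cong (λ t → + t * C[ m ℕ.+ j , j ] * z ^ j) (binomial-above m<j)
  termwise : ∀ j → legendreCoeff (suc (suc m)) (suc j) * z ^ suc j - legendreCoeff m (suc j) * z ^ suc j
                   ≡ w * (+ largeCoeff (suc m) j * z ^ j)
  termwise j = begin
    a * z ^ suc j - b * z ^ suc j                                ≡⟨ factor a b (z ^ suc j) ⟩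
    (a - b) * z ^ suc j                                          ≡⟨ cong (_* z ^ suc j) (legendreCoeff-step m j) ⟩
    + 2 * (+ 2 * + suc m + 1ℤ) * + largeCoeff (suc m) j * (z * z ^ j)
                                                                 ≡⟨ regroup (+ 2 * + suc m + 1ℤ) (+ largeCoeff (suc m) j) z (z ^ j) ⟩
    w * (+ largeCoeff (suc m) j * z ^ j)                         ∎
    where
    a = legendreCoeff (suc (suc m)) (suc j)
    b = legendreCoeff m (suc j)
    factor : ∀ a b x → a * x - b * x ≡ (a - b) * x
    factor = solve-∀
    regroup : ∀ d t z y → + 2 * d * t * (z * y) ≡ + 2 * z * d * (t * y)
    regroup = solve-∀
legendreSquareSum : ℕ → ℤ → ℤ
legendreSquareSum n z = homSum n (squareCoeff n) z (z + 1ℤ)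

s≡homSum : ∀ m z → s (suc m) z ≡ homSum m (narayanaCoeff m) z (z + 1ℤ)
s≡homSum m z = sumFrom1-suc m _

legendreSquareSum-difference : ∀ m z →
  legendreSquareSum (suc (suc m)) z - legendreSquareSum m z
  ≡ homSum (suc (suc m))
      (λ k → squareCoeff (suc (suc m)) k - squareCoeff m k + + 2 * shift (squareCoeff m) k - shift (shift (squareCoeff m)) k)
      z (z + 1ℤ)
legendreSquareSum-difference m z = begin
  H (squareCoeff M) - legendreSquareSum m z
    ≡⟨ cong (λ t → H (squareCoeff M) - t) (homSum-raise m (squareCoeff m) z (vanish ℕ.≤-refl) (vanish (ℕ.n≤1+n _))) ⟩
  H (squareCoeff M) - (H (squareCoeff m) - + 2 * H (shift (squareCoeff m)) + H (shift (shift (squareCoeff m))))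
    ≡⟨ rearrange (H (squareCoeff M)) (H (squareCoeff m)) (H (shift (squareCoeff m))) (H (shift (shift (squareCoeff m)))) ⟩
  H (squareCoeff M) - H (squareCoeff m) + + 2 * H (shift (squareCoeff m)) - H (shift (shift (squareCoeff m)))
    ≡⟨ sym (linear (squareCoeff M) (squareCoeff m) (shift (squareCoeff m)) (shift (shift (squareCoeff m)))) ⟩
  H (λ k → squareCoeff M k - squareCoeff m k + + 2 * shift (squareCoeff m) k - shift (shift (squareCoeff m)) k) ∎
  where
  open ≡-Reasoning
  M = suc (suc m)
  w = z + 1ℤ
  H : (ℕ → ℤ) → ℤ
  H d = homSum M d z w
  vanish : ∀ {k} → m ℕ.< k → squareCoeff m k ≡ 0ℤ
  vanish m<k = cong (λ t → + t * + t) (binomial-above m<k)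
  rearrange : ∀ a b c d → a - (b - + 2 * c + d) ≡ a - b + + 2 * c - d
  rearrange = solve-∀
  linear : ∀ a b c d → H (λ k → a k - b k + + 2 * c k - d k) ≡ H a - H b + + 2 * H c - H d
  linear a b c d = begin
    H (λ k → a k - b k + + 2 * c k - d k)   ≡⟨ homSum-- M (λ k → a k - b k + + 2 * c k) d z w ⟩
    H (λ k → a k - b k + + 2 * c k) - H d   ≡⟨ cong (_- H d) (homSum-+ M (λ k → a k - b k) (λ k → + 2 * c k) z w) ⟩
    H (λ k → a k - b k) + H (λ k → + 2 * c k) - H d
                                            ≡⟨ cong₂ (λ s t → s + t - H d) (homSum-- M a b z w) (homSum-* M (+ 2) c z w) ⟩
    H a - H b + + 2 * H c - H d             ∎

legendreSquareSum-step : ∀ m z →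
  legendreSquareSum (suc (suc m)) z - legendreSquareSum m z ≡ + 2 * z * (z + 1ℤ) * ((+ 2 * + suc m + 1ℤ) * s (suc m) z)
legendreSquareSum-step m z = begin
  legendreSquareSum (suc (suc m)) z - legendreSquareSum m z
    ≡⟨ legendreSquareSum-difference m z ⟩
  homSum M (λ k → squareCoeff M k - squareCoeff m k + + 2 * shift (squareCoeff m) k - shift (shift (squareCoeff m)) k) z w
    ≡⟨ homSum-cong M z w (λ k → sym (littleCoeff-step m k)) ⟩
  homSum M (λ k → c * shift (narayanaCoeff m) k) z w
    ≡⟨ homSum-* M c (shift (narayanaCoeff m)) z w ⟩
  c * homSum M (shift (narayanaCoeff m)) z w
    ≡⟨ cong (c *_) (homSum-shift (suc m) (narayanaCoeff m) z w) ⟩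
  c * (z * homSum (suc m) (narayanaCoeff m) z w)
    ≡⟨ cong (λ t → c * (z * t)) (homSum-pad m (narayanaCoeff m) z w narayanaTop) ⟩
  c * (z * (w * homSum m (narayanaCoeff m) z w))
    ≡⟨ cong (λ t → c * (z * (w * t))) (sym (s≡homSum m z)) ⟩
  c * (z * (w * s (suc m) z))
    ≡⟨ regroup (+ m) z (s (suc m) z) ⟩
  + 2 * z * w * ((+ 2 * + suc m + 1ℤ) * s (suc m) z) ∎
  where
  open ≡-Reasoning
  M = suc (suc m)
  w = z + 1ℤ
  c = + 2 * (+ 2 * + suc m + 1ℤ)
  narayanaTop : narayanaCoeff m (suc m) ≡ 0ℤ
  narayanaTop = *-cancelˡ-≡ (+ suc m) _ _
    (trans ([1+m]littleCoeff≡C[1+m,1+i]C[1+m,i] m (suc m))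
           (trans (cong (λ t → + t * C[ suc m , suc m ]) (binomial-above {suc m} ℕ.≤-refl)) (sym (*-zeroʳ (+ suc m)))))
  regroup : ∀ m z t →
    + 2 * (+ 2 * (1ℤ + m) + 1ℤ) * (z * ((z + 1ℤ) * t)) ≡ + 2 * z * (z + 1ℤ) * ((+ 2 * (1ℤ + m) + 1ℤ) * t)
  regroup = solve-∀

-- Telescoping

twisted-telescope : ∀ ε w (f d : ℕ → ℤ) → ε * ε ≡ 1ℤ →
  (∀ m → w * f (suc m) ≡ ε ^ suc m * (d (suc (suc m)) - d m)) →
  ∀ N → w * sumTo N f ≡ ε ^ N * d (suc N) + ε ^ suc N * d N + (w * f 0 - d 1 - ε * d 0)
twisted-telescope ε w f d ε²≡1 step zero = base ε w (f 0) (d 0) (d 1)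
  where
  base : ∀ ε w f₀ d₀ d₁ → w * f₀ ≡ 1ℤ * d₁ + ε * 1ℤ * d₀ + (w * f₀ - d₁ - ε * d₀)
  base = solve-∀
twisted-telescope ε w f d ε²≡1 step (suc N) = begin
  w * (sumTo N f + f (suc N))
    ≡⟨ *-distribˡ-+ w _ _ ⟩
  w * sumTo N f + w * f (suc N)
    ≡⟨ cong₂ _+_ (twisted-telescope ε w f d ε²≡1 step N) (step N) ⟩
  e * d (suc N) + ε * e * d N + k + ε * e * (d (suc (suc N)) - d N)
    ≡⟨ collapse ε e (d N) (d (suc N)) (d (suc (suc N))) k ⟩
  ε * e * d (suc (suc N)) + 1ℤ * e * d (suc N) + k
    ≡⟨ cong (λ t → ε * e * d (suc (suc N)) + t * e * d (suc N) + k) (sym ε²≡1) ⟩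
  ε * e * d (suc (suc N)) + ε * ε * e * d (suc N) + k
    ≡⟨ reassoc ε e (d (suc N)) (d (suc (suc N))) k ⟩
  ε ^ suc N * d (suc (suc N)) + ε ^ suc (suc N) * d (suc N) + k ∎
  where
  open ≡-Reasoning
  e = ε ^ N
  k = w * f 0 - d 1 - ε * d 0
  collapse : ∀ ε e d₀ d₁ d₂ k → e * d₁ + ε * e * d₀ + k + ε * e * (d₂ - d₀) ≡ ε * e * d₂ + 1ℤ * e * d₁ + k
  collapse = solve-∀
  reassoc : ∀ ε e d₁ d₂ k → ε * e * d₂ + ε * ε * e * d₁ + k ≡ ε * e * d₂ + ε * (ε * e) * d₁ + k
  reassoc = solve-∀

odd-weighted-telescope : ∀ ε w (u d : ℕ → ℤ) → ε * ε ≡ 1ℤ →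
  (∀ m → d (suc (suc m)) - d m ≡ w * ((+ 2 * + suc m + 1ℤ) * u (suc m))) →
  ∀ N → w * sumTo N (λ k → + (2 ℕ.* k ℕ.+ 1) * ε ^ k * u k)
        ≡ ε ^ N * d (suc N) + ε ^ suc N * d N + (w * u 0 - d 1 - ε * d 0)
odd-weighted-telescope ε w u d ε²≡1 recurrence N =
  trans (twisted-telescope ε w _ d ε²≡1 step N)
        (cong (λ t → ε ^ N * d (suc N) + ε ^ suc N * d N + (w * t - d 1 - ε * d 0)) (*-identityˡ (u 0)))
  where
  step : ∀ m → w * (+ (2 ℕ.* suc m ℕ.+ 1) * ε ^ suc m * u (suc m)) ≡ ε ^ suc m * (d (suc (suc m)) - d m)
  step m = begin
    w * (+ (2 ℕ.* suc m ℕ.+ 1) * ε ^ suc m * u (suc m)) ≡⟨ cong (λ t → w * ((t + 1ℤ) * ε ^ suc m * u (suc m)))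
                                                              (pos-* 2 (suc m)) ⟩
    w * ((+ 2 * + suc m + 1ℤ) * ε ^ suc m * u (suc m))  ≡⟨ regroup w (+ 2 * + suc m + 1ℤ) (ε ^ suc m) (u (suc m)) ⟩
    ε ^ suc m * (w * ((+ 2 * + suc m + 1ℤ) * u (suc m))) ≡⟨ cong (ε ^ suc m *_) (sym (recurrence m)) ⟩
    ε ^ suc m * (d (suc (suc m)) - d m)                  ∎
    where
    open ≡-Reasoning
    regroup : ∀ w o e u → w * (o * e * u) ≡ e * (w * (o * u))
    regroup = solve-∀

±1² : ∀ {ε} → ε ≡ 1ℤ ⊎ ε ≡ -1ℤ → ε * ε ≡ 1ℤ
±1² (inj₁ refl) = refl
±1² (inj₂ refl) = refl

^k*^k≡1 : ∀ ε → ε * ε ≡ 1ℤ → ∀ k → ε ^ k * ε ^ k ≡ 1ℤ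
^k*^k≡1 ε ε²≡1 zero    = refl
^k*^k≡1 ε ε²≡1 (suc k) = begin
  ε * ε ^ k * (ε * ε ^ k)     ≡⟨ interchange ε (ε ^ k) ⟩
  ε * ε * (ε ^ k * ε ^ k)     ≡⟨ cong₂ _*_ ε²≡1 (^k*^k≡1 ε ε²≡1 k) ⟩
  1ℤ                          ∎
  where
  open ≡-Reasoning
  interchange : ∀ a b → a * b * (a * b) ≡ a * a * (b * b)
  interchange = solve-∀

-- Arithmetic modulo p

module Congruence (n : ℤ) where

  open ℤ∣ using (_∣_; divides; ∣m∣n⇒∣m+n; ∣m⇒∣-m; ∣m⇒∣m*n; ∣n⇒∣m*n)

  infix 4 _≈_
  record _≈_ (a b : ℤ) : Set where
    constructor mk≈
    field ∣-difference : n ∣ a - b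
  open _≈_ public

  private
    via : ∀ {a b} c → c ≡ a - b → n ∣ c → a ≈ b
    via c eq n∣c = mk≈ (subst (n ∣_) eq n∣c)

  ∣⇒≈0 : ∀ {a} → n ∣ a → a ≈ 0ℤ
  ∣⇒≈0 {a} = via a (sym (+-identityʳ a))

  ≈-refl : ∀ {a} → a ≈ a
  ≈-refl {a} = via 0ℤ (sym (+-inverseʳ a)) (divides 0ℤ refl)

  ≈-sym : ∀ {a b} → a ≈ b → b ≈ a
  ≈-sym {a} {b} (mk≈ h) = via (- (a - b)) (negate a b) (∣m⇒∣-m h)
    where
    negate : ∀ a b → - (a - b) ≡ b - a
    negate = solve-∀

  ≈-trans : ∀ {a b c} → a ≈ b → b ≈ c → a ≈ c
  ≈-trans {a} {b} {c} (mk≈ h₁) (mk≈ h₂) = via ((a - b) + (b - c)) (chain a b c) (∣m∣n⇒∣m+n h₁ h₂)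
    where
    chain : ∀ a b c → (a - b) + (b - c) ≡ a - c
    chain = solve-∀

  ≈-isEquivalence : IsEquivalence _≈_
  ≈-isEquivalence = record { refl = ≈-refl ; sym = ≈-sym ; trans = ≈-trans }

  ≈-setoid : Setoid 0ℓ 0ℓ
  ≈-setoid = record { isEquivalence = ≈-isEquivalence }

  module ≈-Reasoning = SetoidReasoning ≈-setoid

  ≡⇒≈ : ∀ {a b} → a ≡ b → a ≈ b
  ≡⇒≈ refl = ≈-refl

  +-cong : ∀ {a b c d} → a ≈ b → c ≈ d → a + c ≈ b + d
  +-cong {a} {b} {c} {d} (mk≈ h₁) (mk≈ h₂) = via ((a - b) + (c - d)) (regroup a b c d) (∣m∣n⇒∣m+n h₁ h₂)
    where
    regroup : ∀ a b c d → (a - b) + (c - d) ≡ (a + c) - (b + d)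
    regroup = solve-∀

  -‿cong : ∀ {a b} → a ≈ b → - a ≈ - b
  -‿cong {a} {b} (mk≈ h) = via (- (a - b)) (negate a b) (∣m⇒∣-m h)
    where
    negate : ∀ a b → - (a - b) ≡ - a - - b
    negate = solve-∀

  *-cong : ∀ {a b c d} → a ≈ b → c ≈ d → a * c ≈ b * d
  *-cong {a} {b} {c} {d} (mk≈ h₁) (mk≈ h₂) =
    via ((a - b) * c + b * (c - d)) (regroup a b c d) (∣m∣n⇒∣m+n (∣m⇒∣m*n c h₁) (∣n⇒∣m*n b h₂))
    where
    regroup : ∀ a b c d → (a - b) * c + b * (c - d) ≡ a * c - b * d
    regroup = solve-∀

  sumTo-congᵐ : ∀ m {f g : ℕ → ℤ} → (∀ j → j ℕ.≤ m → f j ≈ g j) → sumTo m f ≈ sumTo m g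
  sumTo-congᵐ zero    f≈g = f≈g 0 ℕ.z≤n
  sumTo-congᵐ (suc m) f≈g = +-cong (sumTo-congᵐ m (λ j j≤m → f≈g j (ℕ.m≤n⇒m≤1+n j≤m))) (f≈g (suc m) ℕ.≤-refl)

module PrimeModulus (q : ℕ) (p-prime : Prime (suc q)) where

  p : ℕ
  p = suc q

  open Congruence (+ p) public
  open ℤ∣ using (_∣_; divides; ∣-refl; ∣⇒∣ᵤ; ∣ᵤ⇒∣; ∣m⇒∣m*n; ∣n⇒∣m*n)

  p∤1 : ¬ (+ p ∣ 1ℤ)
  p∤1 p∣1 = ¬prime[1] (subst Prime (ℕ∣.∣1⇒≡1 (∣⇒∣ᵤ p∣1)) p-prime)

  euclid : ∀ a b → + p ∣ a * b → (+ p ∣ a) ⊎ (+ p ∣ b)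
  euclid a b p∣ab =
    Sum.map ∣ᵤ⇒∣ ∣ᵤ⇒∣ (euclidsLemma ∣ a ∣ ∣ b ∣ p-prime (subst (p ℕ∣.∣_) (abs-* a b) (∣⇒∣ᵤ p∣ab)))

  p∤2 : p ≢ 2 → ¬ (+ p ∣ + 2)
  p∤2 p≢2 p∣2 = Sum.[ (λ p≡1 → ¬prime[1] (subst Prime p≡1 p-prime)) , p≢2 ] (irreducible[2] (∣⇒∣ᵤ p∣2))

  coprime⇒p∤ : ∀ a b → gcd (+ p) (a * b) ≡ 1ℤ → ¬ (+ p ∣ a) × ¬ (+ p ∣ b)
  coprime⇒p∤ a b coprime = (λ p∣a → p∤ab (∣m⇒∣m*n b p∣a)) , (λ p∣b → p∤ab (∣n⇒∣m*n a p∣b))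
    where
    p∤ab : ¬ (+ p ∣ a * b)
    p∤ab p∣ab =
      p∤1 (∣ᵤ⇒∣ (subst (λ g → p ℕ∣.∣ ∣ g ∣) coprime (gcd-greatest {+ p} {a * b} {+ p} ℕ∣.∣-refl (∣⇒∣ᵤ p∣ab))))

  p∤*-closed : ∀ {a b} → ¬ (+ p ∣ a) → ¬ (+ p ∣ b) → ¬ (+ p ∣ a * b)
  p∤*-closed p∤a p∤b p∣ab = Sum.[ p∤a , p∤b ] (euclid _ _ p∣ab)

  p∤1+k : ∀ {k} → k ℕ.< q → ¬ (+ p ∣ + suc k)
  p∤1+k k<q p∣1+k = ℕ.<⇒≱ (ℕ.s≤s k<q) (ℕ∣.∣⇒≤ (∣⇒∣ᵤ p∣1+k))

  p∣[1+k]x⇒p∣x : ∀ {k} x → k ℕ.< q → + p ∣ + suc k * x → + p ∣ x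
  p∣[1+k]x⇒p∣x x k<q p∣kx = Sum.[ ⊥-elim ∘ p∤1+k k<q , id ] (euclid _ x p∣kx)

  *-cancelˡ-≈ : ∀ {c a b} → ¬ (+ p ∣ c) → c * a ≈ c * b → a ≈ b
  *-cancelˡ-≈ {c} {a} {b} p∤c (mk≈ h) =
    mk≈ (Sum.[ ⊥-elim ∘ p∤c , id ] (euclid c (a - b) (subst (+ p ∣_) (factor c a b) h)))
    where
    factor : ∀ c a b → c * a - c * b ≡ c * (a - b)
    factor = solve-∀

  p∣C[p,1+k] : ∀ {k} → k ℕ.< q → + p ∣ C[ p , suc k ]
  p∣C[p,1+k] {k} k<q = p∣[1+k]x⇒p∣x C[ p , suc k ] k<q
    (subst (+ p ∣_) (sym ([1+k]C[1+n,1+k]≡[1+n]C[n,k] q k)) (∣m⇒∣m*n C[ q , k ] ∣-refl))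

  p∣C[p+k,1+k] : ∀ {k} → k ℕ.< q → + p ∣ C[ p ℕ.+ k , suc k ]
  p∣C[p+k,1+k] {k} k<q = p∣[1+k]x⇒p∣x C[ p ℕ.+ k , suc k ] k<q
    (subst (+ p ∣_) (sym (trans ([1+k]C[n,1+k]≡[n-k]C[n,k] (p ℕ.+ k) k) (cong (_* C[ p ℕ.+ k , k ]) (cancel (+ p) (+ k)))))
      (∣m⇒∣m*n C[ p ℕ.+ k , k ] ∣-refl))
    where
    cancel : ∀ a b → a + b - b ≡ a
    cancel = solve-∀

  C[N,k]≈[-1]^k : ∀ {N} → + p ∣ + suc N → ∀ {k} → k ℕ.≤ q → C[ N , k ] ≈ -1ℤ ^ k
  C[N,k]≈[-1]^k p∣1+N {zero}  _     = ≈-refl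
  C[N,k]≈[-1]^k {N} p∣1+N {suc k} 1+k≤q = begin
    C[ N , suc k ]                                ≈⟨ mk≈ (subst (+ p ∣_) (x+y≡x--y C[ N , suc k ] C[ N , k ]) p∣row) ⟩
    - C[ N , k ]                                  ≈⟨ -‿cong (C[N,k]≈[-1]^k p∣1+N (ℕ.<⇒≤ 1+k≤q)) ⟩
    - (-1ℤ ^ k)                                   ≡⟨ neg≡-1* (-1ℤ ^ k) ⟩
    -1ℤ ^ suc k                                   ∎
    where
    open ≈-Reasoning
    p∣row : + p ∣ C[ N , suc k ] + C[ N , k ]
    p∣row = p∣[1+k]x⇒p∣x (C[ N , suc k ] + C[ N , k ]) 1+k≤q
      (subst (+ p ∣_) (sym (trans (cong (+ suc k *_) (+-comm C[ N , suc k ] C[ N , k ])) ([1+k]C[1+n,1+k]≡[1+n]C[n,k] N k)))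
        (∣m⇒∣m*n C[ N , k ] p∣1+N))
    x+y≡x--y : ∀ x y → x + y ≡ x - - y
    x+y≡x--y = solve-∀
    neg≡-1* : ∀ x → - x ≡ -1ℤ * x
    neg≡-1* = solve-∀

  sumTo-≈-head : ∀ (f : ℕ → ℤ) → (∀ {j} → j ℕ.< q → + p ∣ f (suc j)) → ∀ {m} → m ℕ.≤ q → sumTo m f ≈ f 0
  sumTo-≈-head f p∣f {zero}  _     = ≈-refl
  sumTo-≈-head f p∣f {suc m} 1+m≤q = begin
    sumTo m f + f (suc m)   ≈⟨ +-cong (sumTo-≈-head f p∣f (ℕ.<⇒≤ 1+m≤q)) (∣⇒≈0 (p∣f 1+m≤q)) ⟩
    f 0 + 0ℤ                ≡⟨ +-identityʳ (f 0) ⟩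
    f 0                     ∎
    where open ≈-Reasoning

  sumTo-≈-ends : ∀ (f : ℕ → ℤ) → (∀ {j} → j ℕ.< q → + p ∣ f (suc j)) → sumTo p f ≈ f 0 + f p
  sumTo-≈-ends f p∣f = +-cong (sumTo-≈-head f p∣f ℕ.≤-refl) ≈-refl

  freshman's-dream : ∀ x → (x + 1ℤ) ^ p ≈ x ^ p + 1ℤ
  freshman's-dream x = begin
    (x + 1ℤ) ^ p
      ≡⟨ binomial-theorem p x 1ℤ ⟩
    homSum p C[ p ,_] x 1ℤ
      ≈⟨ sumTo-≈-ends _ (λ k<q → ∣m⇒∣m*n _ (∣m⇒∣m*n _ (p∣C[p,1+k] k<q))) ⟩
    1ℤ * 1ℤ * 1ℤ ^ p + C[ p , p ] * x ^ p * 1ℤ ^ (q ℕ.∸ q)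
      ≡⟨ cong₂ (λ s t → 1ℤ * 1ℤ * s + C[ p , p ] * x ^ p * 1ℤ ^ t) (^-zeroˡ p) (ℕ.n∸n≡0 q) ⟩
    1ℤ * 1ℤ * 1ℤ + C[ p , p ] * x ^ p * 1ℤ
      ≡⟨ cong (λ t → 1ℤ + + t * x ^ p * 1ℤ) (binomial-diag p) ⟩
    1ℤ + 1ℤ * x ^ p * 1ℤ
      ≡⟨ tidy (x ^ p) ⟩
    x ^ p + 1ℤ ∎
    where
    open ≈-Reasoning
    tidy : ∀ y → 1ℤ + 1ℤ * y * 1ℤ ≡ y + 1ℤ
    tidy = solve-∀

  fermat-up : ∀ x → x ^ p ≈ x → (x + 1ℤ) ^ p ≈ x + 1ℤ
  fermat-up x xᵖ≈x = ≈-trans (freshman's-dream x) (+-cong xᵖ≈x ≈-refl)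

  fermat-down : ∀ x → (x + 1ℤ) ^ p ≈ x + 1ℤ → x ^ p ≈ x
  fermat-down x h = begin
    x ^ p                  ≡⟨ add-sub (x ^ p) ⟩
    x ^ p + 1ℤ - 1ℤ        ≈⟨ +-cong (≈-sym (freshman's-dream x)) ≈-refl ⟩
    (x + 1ℤ) ^ p - 1ℤ      ≈⟨ +-cong h ≈-refl ⟩
    x + 1ℤ - 1ℤ            ≡⟨ sym (add-sub x) ⟩
    x                      ∎
    where
    open ≈-Reasoning
    add-sub : ∀ x → x ≡ x + 1ℤ - 1ℤ
    add-sub = solve-∀

  fermat : ∀ x → x ^ p ≈ x
  fermat (+ zero)          = ≈-refl
  fermat (+ suc n)         = subst (λ t → t ^ p ≈ t) (+-comm (+ n) 1ℤ) (fermat-up (+ n) (fermat (+ n)))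
  fermat -[1+ zero ]       = fermat-down -1ℤ ≈-refl
  fermat -[1+ suc n ]      = fermat-down -[1+ suc n ] (fermat -[1+ n ])

  unit^q≈1 : ∀ {ε} → ε * ε ≡ 1ℤ → ε ^ q ≈ 1ℤ
  unit^q≈1 {ε} ε²≡1 = *-cancelˡ-≈ p∤ε (≈-trans (fermat ε) (≡⇒≈ (sym (*-identityʳ ε))))
    where
    p∤ε : ¬ (+ p ∣ ε)
    p∤ε p∣ε = p∤1 (subst (+ p ∣_) ε²≡1 (∣m⇒∣m*n ε p∣ε))

  C[p+p,p]≈2 : C[ p ℕ.+ p , p ] ≈ + 2
  C[p+p,p]≈2 = begin
    C[ p ℕ.+ p , p ]         ≡⟨ C[2n,n]≡2C[2n-1,n-1] q ⟩
    + 2 * C[ p ℕ.+ q , q ]   ≈⟨ *-cong (≈-refl {+ 2}) (≈-trans (C[N,k]≈[-1]^k p∣2p ℕ.≤-refl) (unit^q≈1 refl)) ⟩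
    + 2 * 1ℤ                 ≡⟨⟩
    + 2                      ∎
    where
    open ≈-Reasoning
    p∣2p : + p ∣ + suc (p ℕ.+ q)
    p∣2p = divides (+ 2) (double (+ q))
      where
      double : ∀ q → 1ℤ + ((1ℤ + q) + q) ≡ + 2 * (1ℤ + q)
      double = solve-∀

  legendreSum-p : ∀ z → legendreSum p z ≈ 1ℤ + + 2 * z
  legendreSum-p z = begin
    legendreSum p z                                  ≈⟨ sumTo-≈-ends _ (λ j<q → ∣m⇒∣m*n _ (∣m⇒∣m*n _ (p∣C[p,1+k] j<q))) ⟩
    1ℤ + C[ p , p ] * C[ p ℕ.+ p , p ] * z ^ p        ≈⟨ +-cong (≈-refl {1ℤ})
                                                          (*-cong (*-cong (≡⇒≈ (cong +_ (binomial-diag p))) C[p+p,p]≈2) (fermat z)) ⟩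
    1ℤ + 1ℤ * + 2 * z                                ≡⟨⟩
    1ℤ + + 2 * z                                     ∎
    where open ≈-Reasoning

  legendreSum-q : ∀ z → legendreSum q z ≈ 1ℤ
  legendreSum-q z = sumTo-≈-head _ p∣term ℕ.≤-refl
    where
    p∣term : ∀ {j} → j ℕ.< q → + p ∣ legendreCoeff q (suc j) * z ^ suc j
    p∣term {j} j<q = ∣m⇒∣m*n (z ^ suc j) (∣n⇒∣m*n C[ q , suc j ]
      (subst (λ t → + p ∣ C[ t , suc j ]) (sym (ℕ.+-suc q j)) (p∣C[p+k,1+k] j<q)))

  legendreSquareSum-p : ∀ z → legendreSquareSum p z ≈ 1ℤ + + 2 * z
  legendreSquareSum-p z = begin
    legendreSquareSum p z
      ≈⟨ sumTo-≈-ends _ (λ j<q → ∣m⇒∣m*n _ (∣m⇒∣m*n _ (∣m⇒∣m*n _ (p∣C[p,1+k] j<q)))) ⟩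
    1ℤ * 1ℤ * (z + 1ℤ) ^ p + C[ p , p ] * C[ p , p ] * z ^ p * (z + 1ℤ) ^ (q ℕ.∸ q)
      ≡⟨ cong₂ (λ c e → 1ℤ * 1ℤ * (z + 1ℤ) ^ p + + c * + c * z ^ p * (z + 1ℤ) ^ e) (binomial-diag p) (ℕ.n∸n≡0 q) ⟩
    1ℤ * (z + 1ℤ) ^ p + 1ℤ * z ^ p * 1ℤ
      ≈⟨ +-cong (*-cong (≈-refl {1ℤ}) (fermat (z + 1ℤ))) (*-cong (*-cong (≈-refl {1ℤ}) (fermat z)) (≈-refl {1ℤ})) ⟩
    1ℤ * (z + 1ℤ) + 1ℤ * z * 1ℤ
      ≡⟨ tidy z ⟩
    1ℤ + + 2 * z ∎
    where
    open ≈-Reasoning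
    tidy : ∀ z → 1ℤ * (z + 1ℤ) + 1ℤ * z * 1ℤ ≡ 1ℤ + + 2 * z
    tidy = solve-∀

  legendreSquareSum-q : ∀ z → legendreSquareSum q z ≈ 1ℤ
  legendreSquareSum-q z = begin
    homSum q (squareCoeff q) z w
      ≈⟨ sumTo-congᵐ q (λ k k≤q → *-cong (*-cong (square≈1 k≤q) ≈-refl) ≈-refl) ⟩
    homSum q (λ _ → 1ℤ) z w
      ≡⟨ sym (*-identityˡ _) ⟩
    1ℤ * homSum q (λ _ → 1ℤ) z w
      ≡⟨ cong (_* homSum q (λ _ → 1ℤ) z w) (w-z≡1 z) ⟩
    (w - z) * homSum q (λ _ → 1ℤ) z w
      ≡⟨ homSum-geometric q z w ⟩
    w ^ p - z ^ p
      ≈⟨ +-cong (fermat w) (-‿cong (fermat z)) ⟩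
    w - z
      ≡⟨ sym (w-z≡1 z) ⟩
    1ℤ ∎
    where
    open ≈-Reasoning
    w = z + 1ℤ
    w-z≡1 : ∀ z → 1ℤ ≡ z + 1ℤ - z
    w-z≡1 = solve-∀
    square≈1 : ∀ {k} → k ℕ.≤ q → squareCoeff q k ≈ 1ℤ
    square≈1 {k} k≤q = ≈-trans (*-cong alt alt) (≡⇒≈ (^k*^k≡1 -1ℤ refl k))
      where
      alt : C[ q , k ] ≈ -1ℤ ^ k
      alt = C[N,k]≈[-1]^k ∣-refl k≤q

  module _ {ε z : ℤ} (ε²≡1 : ε * ε ≡ 1ℤ) where

    endpoints : ∀ {a b} c → a ≈ 1ℤ + + 2 * z → b ≈ 1ℤ →
                ε ^ q * a + ε * ε ^ q * b + c ≈ 1ℤ * (1ℤ + + 2 * z) + ε * 1ℤ * 1ℤ + c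
    endpoints c a≈ b≈ = +-cong (+-cong (*-cong εᵠ≈1 a≈) (*-cong (*-cong (≈-refl {ε}) εᵠ≈1) b≈)) (≈-refl {c})
      where
      εᵠ≈1 : ε ^ q ≈ 1ℤ
      εᵠ≈1 = unit^q≈1 ε²≡1

    large-schröder-sum≈1 : ¬ (+ p ∣ + 2 * z) → sumTo q (λ k → + (2 ℕ.* k ℕ.+ 1) * ε ^ k * S k z) ≈ 1ℤ
    large-schröder-sum≈1 p∤2z = *-cancelˡ-≈ p∤2z (begin
      + 2 * z * sumTo q (λ k → + (2 ℕ.* k ℕ.+ 1) * ε ^ k * S k z)
        ≡⟨ odd-weighted-telescope ε (+ 2 * z) (λ k → S k z) D ε²≡1 (λ m → legendreSum-step m z) q ⟩
      ε ^ q * D p + ε * ε ^ q * D q + (+ 2 * z * S 0 z - D 1 - ε * D 0)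
        ≈⟨ endpoints _ (legendreSum-p z) (legendreSum-q z) ⟩
      1ℤ * (1ℤ + + 2 * z) + ε * 1ℤ * 1ℤ + (+ 2 * z * S 0 z - D 1 - ε * D 0)
        ≡⟨ evaluate z ε ⟩
      + 2 * z * 1ℤ ∎)
      where
      open ≈-Reasoning
      D : ℕ → ℤ
      D n = legendreSum n z
      evaluate : ∀ z ε → 1ℤ * (1ℤ + + 2 * z) + ε * 1ℤ * 1ℤ + (+ 2 * z * 1ℤ - (1ℤ + + 2 * (z * 1ℤ)) - ε * 1ℤ)
                         ≡ + 2 * z * 1ℤ
      evaluate = solve-∀

    little-schröder-sum≈0 : ¬ (+ p ∣ + 2 * z * (z + 1ℤ)) → sumTo q (λ k → + (2 ℕ.* k ℕ.+ 1) * ε ^ k * s k z) ≈ 0ℤ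
    little-schröder-sum≈0 p∤w = *-cancelˡ-≈ p∤w (begin
      w * sumTo q (λ k → + (2 ℕ.* k ℕ.+ 1) * ε ^ k * s k z)
        ≡⟨ odd-weighted-telescope ε w (λ k → s k z) E ε²≡1 (λ m → legendreSquareSum-step m z) q ⟩
      ε ^ q * E p + ε * ε ^ q * E q + (w * 0ℤ - E 1 - ε * E 0)
        ≈⟨ endpoints _ (legendreSquareSum-p z) (legendreSquareSum-q z) ⟩
      1ℤ * (1ℤ + + 2 * z) + ε * 1ℤ * 1ℤ + (w * 0ℤ - E 1 - ε * E 0)
        ≡⟨ evaluate z ε ⟩
      w * 0ℤ ∎)
      where
      open ≈-Reasoning
      w = + 2 * z * (z + 1ℤ)
      E : ℕ → ℤ
      E n = legendreSquareSum n z
      evaluate : ∀ z ε → 1ℤ * (1ℤ + + 2 * z) + ε * 1ℤ * 1ℤ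
                         + (+ 2 * z * (z + 1ℤ) * 0ℤ - (1ℤ * 1ℤ * ((z + 1ℤ) * 1ℤ) + 1ℤ * (z * 1ℤ) * 1ℤ) - ε * 1ℤ)
                         ≡ + 2 * z * (z + 1ℤ) * 0ℤ
      evaluate = solve-∀

open import Data.Integer.Divisibility using (_∣_)

lemma3p4 : (p : ℕ) → Prime p → p ≢ 2 → (ε : ℤ) → (ε ≡ 1ℤ ⊎ ε ≡ -1ℤ) → (z : ℤ) →
    gcd (+ p) (z * (z + 1ℤ)) ≡ 1ℤ →
    ((+ p) ∣ (sumTo (p ℕ.∸ 1) (λ k → (+ (2 ℕ.* k ℕ.+ 1)) * ε ^ k * S k z) - 1ℤ))
    × ((+ p) ∣ (sumTo (p ℕ.∸ 1) (λ k → (+ (2 ℕ.* k ℕ.+ 1)) * ε ^ k * s k z) - 0ℤ))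
lemma3p4 zero    ()
lemma3p4 (suc q) p-prime p≢2 ε ε≡±1 z coprime =
  ℤ∣.∣⇒∣ᵤ (∣-difference (large-schröder-sum≈1 (±1² ε≡±1) p∤2z)) ,
  ℤ∣.∣⇒∣ᵤ (∣-difference (little-schröder-sum≈0 (±1² ε≡±1) (p∤*-closed p∤2z p∤z+1)))
  where
  open PrimeModulus q p-prime
  p∤z : ¬ (+ suc q ℤ∣.∣ z)
  p∤z = proj₁ (coprime⇒p∤ z (z + 1ℤ) coprime)
  p∤z+1 : ¬ (+ suc q ℤ∣.∣ z + 1ℤ)
  p∤z+1 = proj₂ (coprime⇒p∤ z (z + 1ℤ) coprime)
  p∤2z : ¬ (+ suc q ℤ∣.∣ + 2 * z)
  p∤2z = p∤*-closed (p∤2 p≢2) p∤z
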